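{- For all $t,u\in\mathrm{PT}$: $t\,\sigma'_{\mathrm{PT}}\,u$ if and only if $t^{\mathfrak m'}=u^{\mathfrak m'}$.
   Context: A tree is a nonempty prefix-closed finitely branching set $A\subseteq(\mathbb N^+)^*$ with $wj\in A$, $i<j$ implying $wi\in A$. A permutation tree is a map $t:A\to\mathrm{Sym}(\mathbb N^+)$ (possibly infinite) such that a node with exactly $n$ children has label in $S_n$ (permutations of $\mathbb N^+$ fixing all $i>n$). Write $t=\langle\pi;t_1,..,t_n\rangle$ (root label $\pi$, subtrees $t_i$); $\bar\epsilon$ is the one-node tree, $\iota$ the identity; $\mathrm{PT}$ is the set of permutation trees. $E'$ is the set of finite permutation trees all of whose labels are $\iota$. $\le'$ is the greatest relation on $\mathrm{PT}$ such that $t\le'u$ with $t=\langle\pi;t_1..t_n\rangle$, $u=\langle\rho;u_1..u_m\rangle$ implies $\pi=\rho$, $m\le n$, $t_i\le'u_i$ for $1\le i\le m$ and $t_i\in E'$ for $m<i\le n$. $t\,\sigma'_{\mathrm{PT}}\,u$ iff there is $w\in\mathrm{PT}$ with $w\le't$ and $w\le'u$. $t^{\mathfrak m'}$ is defined coinductively: $\bar\epsilon^{\mathfrak m'}=\bar\epsilon$; for $t=\langle\pi;t_1..t_n\rangle$, $t^{\mathfrak m'}=(\langle\pi;t_1..t_{n-1}\rangle)^{\mathfrak m'}$ if $t_n\in E'$ and $\pi n=n$, otherwise $t^{\mathfrak m'}=\langle\pi;t_1^{\mathfrak m'},..,t_n^{\mathfrak m'}\rangle$. -}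

module Defs where

open import Data.Nat using (ℕ; zero; suc; _≤_; _<_; _≟_)
open import Data.Nat.Properties using (m≤n⇒m<n∨m≡n; <⇒≤; ≤-refl)
open import Data.List using (List; []; _∷_; _++_)
open import Data.Product using (Σ; _×_; _,_; proj₁; proj₂)
open import Data.Sum using (inj₁; inj₂)
open import Function.Bundles using (_↔_; Inverse)
open import Relation.Nullary using (Dec; yes; no)
open import Relation.Binary.PropositionalEquality using (_≡_; sym; trans; cong)

-- Conventions.  A positive integer k ∈ ℕ⁺ is represented by k-1 : ℕ.
-- So an address w ∈ (ℕ⁺)* is a List ℕ (root first), and a permutation
-- of ℕ⁺ is a bijection ℕ ↔ ℕ.

Sym : Set
Sym = ℕ ↔ ℕ

app : Sym → ℕ → ℕ
app π = Inverse.to π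

-- π ∈ S_n : π fixes every i > n, i.e. every position p ≥ n.
Fixes : Sym → ℕ → Set
Fixes π n = ∀ p → n ≤ p → app π p ≡ p

_≐_ : Sym → Sym → Set
π ≐ ρ = ∀ p → app π p ≡ app ρ p

IsId : Sym → Set
IsId π = ∀ p → app π p ≡ p

-- A tree A ⊆ (ℕ⁺)* (nonempty, prefix closed, finitely
-- branching, closed under wj ↦ wi for i<j) is determined by the number of
-- children `arity w` of each node w; A is then the set of addresses
-- satisfying `Node` below.  The label map t : A → Sym is `label`
-- (values of `arity`/`label` outside A are irrelevant junk).

record PT : Set where
  field
    arity : List ℕ → ℕ
    label : List ℕ → Sym
    inS   : ∀ w → Fixes (label w) (arity w)
open PT public

subAt : PT → List ℕ → PT
arity (subAt t w) v = arity t (w ++ v)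
label (subAt t w) v = label t (w ++ v)
inS   (subAt t w) v = inS t (w ++ v)

sub : PT → ℕ → PT
sub t i = subAt t (i ∷ [])

data Node (t : PT) : List ℕ → Set where
  root : Node t []
  step : ∀ {i w} → i < arity t [] → Node (sub t i) w → Node t (i ∷ w)

-- E' : finite permutation trees all of whose labels are ι
-- (inductive, hence finite)
data E′ (t : PT) : Set where
  e′ : IsId (label t []) → (∀ i → i < arity t [] → E′ (sub t i)) → E′ t

-- ≤' : the greatest relation R with  R ⊆ Φ R  (Knaster–Tarski:
-- t ≤' u iff t R u for some post-fixed point R of Φ).

Φ : (PT → PT → Set) → PT → PT → Set
Φ R t u =
    (label t [] ≐ label u [])
  × (arity u [] ≤ arity t [])
  × (∀ i → i < arity u [] → R (sub t i) (sub u i))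
  × (∀ i → arity u [] ≤ i → i < arity t [] → E′ (sub t i))

_≤′_ : PT → PT → Set₁
t ≤′ u = Σ (PT → PT → Set) λ R → (∀ x y → R x y → Φ R x y) × R t u

σ′ : PT → PT → Set₁
σ′ t u = Σ PT λ w → (w ≤′ t) × (w ≤′ u)

-- equality of permutation trees (as maps A → Sym): same node set and
-- same labels.  Since A is generated by `arity`, this is: on every node
-- of t, arities and labels agree.
_≡T_ : PT → PT → Set
t ≡T u = ∀ w → Node t w → (arity t w ≡ arity u w) × (label t w ≐ label u w)

-- t^m'.  Membership in E' is not decidable constructively for possibly
-- infinite trees, so the case distinction in the definition of t^m' is
-- made through a decision oracle for E'.

DecE′ : Set
DecE′ = (t : PT) → Dec (E′ t)

-- number of children kept at the root: repeatedly drop the last child t_k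
-- while t_k ∈ E' and π k = k  (k-th child = position k-1).
module _ (dec : DecE′) (π : Sym) (n : ℕ) (ch : ℕ → PT) where
  cut : (k : ℕ) → k ≤ n → Fixes π k → Σ ℕ λ j → (j ≤ n) × Fixes π j
  cut zero le fx = zero , le , fx
  cut (suc k) le fx with dec (ch k) | app π k ≟ k
  ... | yes _ | yes eq = cut k (<⇒≤ le) fx′
    where
    fx′ : Fixes π k
    fx′ p k≤p with m≤n⇒m<n∨m≡n k≤p
    ... | inj₁ k<p = fx p k<p
    ... | inj₂ k≡p = trans (cong (app π) (sym k≡p)) (trans eq k≡p)
  ... | _ | _ = suc k , le , fx

cutAt : DecE′ → (t : PT) → (w : List ℕ) →
        Σ ℕ λ j → (j ≤ arity t w) × Fixes (label t w) j
cutAt dec t w =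
  cut dec (label t w) (arity t w) (λ i → subAt t (w ++ i ∷ [])) (arity t w) ≤-refl (inS t w)

-- t^m' : same addresses (stripping only removes trailing children), same
-- labels, and at each node w the arity is reduced as computed by cutAt.
m′ : DecE′ → PT → PT
arity (m′ dec t) w = proj₁ (cutAt dec t w)
label (m′ dec t) w = label t w
inS   (m′ dec t) w = proj₂ (proj₂ (cutAt dec t w))

module Submission where

-- If w ≤′ t, then t is w with some trailing E′-children removed at nodes whose
-- label fixes their positions; m′ removes those children anyway, so m′ w = m′ t,
-- and a common lower bound of t and u forces m′ t = m′ u.  Conversely, if
-- m′ t = m′ u, overlay t and u (taking t's labels where both have a node): the
-- overlay is ≤′ both trees, because wherever it has a child missing from one of
-- them, that child was deleted by m′ in the other and hence lies in E′.  Where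
-- both t and u have a child deleted by m′, both children are in E′, and E′ trees
-- are m′-equal since they all lie ≤′-below the one-node tree ε̄.

open import Defs
open import Function.Bundles using (_⇔_; mk⇔; Equivalence)
open import Function.Base using (id; _∘_)
open import Function.Construct.Identity using (↔-id)
open import Data.Nat using (ℕ; zero; suc; _≤_; _<_; _≟_; _<?_; _⊔_; z≤n)
open import Data.Nat.Properties
  using (≤-refl; ≤-trans; <-≤-trans; ≤-pred; m≤n⇒m≤1+n; m≤n⇒m<n∨m≡n; <⇒≱; ≤⇒≯; ≮⇒≥; ≰⇒>;
         m≤m⊔n; ⊔-lub; ⊔-comm; ⊔-idem)
open import Data.List using (List; []; _∷_)
open import Data.Product using (Σ; _×_; _,_; proj₁; proj₂)
open import Data.Sum using (inj₁; inj₂)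
open import Data.Empty using (⊥-elim)
open import Relation.Nullary using (yes; no; ¬_)
open import Relation.Binary.PropositionalEquality
  using (_≡_; refl; sym; trans; subst; module ≡-Reasoning)

ι : Sym
ι = ↔-id ℕ

ε̄ : PT
arity ε̄ _ = 0
label ε̄ _ = ι
inS ε̄ _ _ _ = refl

-- ≡T packaged as a record, so that the trees can be inferred from a proof.
record _≅_ (t u : PT) : Set where
  constructor mk≅
  field nodewise : t ≡T u
open _≅_

≅-arity : ∀ {t u} → t ≅ u → arity t [] ≡ arity u []
≅-arity t≅u = proj₁ (nodewise t≅u [] root)

≅-label : ∀ {t u} → t ≅ u → label t [] ≐ label u []
≅-label t≅u = proj₂ (nodewise t≅u [] root)

≅-refl : ∀ {t} → t ≅ t
≅-refl = mk≅ λ _ _ → refl , λ _ → refl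

≅-sub : ∀ {t u i} → t ≅ u → i < arity t [] → sub t i ≅ sub u i
≅-sub t≅u h = mk≅ λ p n → nodewise t≅u (_ ∷ p) (step h n)

≅-Node : ∀ {t u w} → t ≅ u → Node t w → Node u w
≅-Node t≅u root       = root
≅-Node t≅u (step h n) = step (subst (_ <_) (≅-arity t≅u) h) (≅-Node (≅-sub t≅u h) n)

≅-sym : ∀ {t u} → t ≅ u → u ≅ t
≅-sym t≅u = mk≅ (flipped t≅u)
  where
  flipped : ∀ {t u} → t ≅ u → u ≡T t
  flipped t≅u .[] root = sym (≅-arity t≅u) , λ q → sym (≅-label t≅u q)
  flipped t≅u .(_ ∷ _) (step h n) =
    flipped (≅-sub t≅u (subst (_ <_) (sym (≅-arity t≅u)) h)) _ n

≅-trans : ∀ {t u v} → t ≅ u → u ≅ v → t ≅ v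
≅-trans t≅u u≅v = mk≅ λ w n →
  let (ar₁ , lab₁) = nodewise t≅u w n
      (ar₂ , lab₂) = nodewise u≅v w (≅-Node t≅u n)
  in trans ar₁ ar₂ , λ q → trans (lab₁ q) (lab₂ q)

E′-≅ : ∀ {t u} → t ≅ u → E′ t → E′ u
E′-≅ t≅u (e′ id-t E′-ch) =
  e′ (λ q → trans (sym (≅-label t≅u q)) (id-t q))
     λ i h → let h′ = subst (i <_) (sym (≅-arity t≅u)) h
             in E′-≅ (≅-sub t≅u h′) (E′-ch i h′)

merge-arity : PT → PT → List ℕ → ℕ
merge-arity t u [] = arity t [] ⊔ arity u []
merge-arity t u (i ∷ p) with i <? arity t [] | i <? arity u []
... | yes _ | yes _ = merge-arity (sub t i) (sub u i) p
... | yes _ | no _  = arity t (i ∷ p)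
... | no _  | yes _ = arity u (i ∷ p)
... | no _  | no _  = 0

merge-label : PT → PT → List ℕ → Sym
merge-label t u [] = label t []
merge-label t u (i ∷ p) with i <? arity t [] | i <? arity u []
... | yes _ | yes _ = merge-label (sub t i) (sub u i) p
... | yes _ | no _  = label t (i ∷ p)
... | no _  | yes _ = label u (i ∷ p)
... | no _  | no _  = ι

merge-inS : ∀ t u p → Fixes (merge-label t u p) (merge-arity t u p)
merge-inS t u [] q h = inS t [] q (≤-trans (m≤m⊔n (arity t []) (arity u [])) h)
merge-inS t u (i ∷ p) with i <? arity t [] | i <? arity u []
... | yes _ | yes _ = merge-inS (sub t i) (sub u i) p
... | yes _ | no _  = inS t (i ∷ p)
... | no _  | yes _ = inS u (i ∷ p)
... | no _  | no _  = λ _ _ → refl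

merge : PT → PT → PT
arity (merge t u) = merge-arity t u
label (merge t u) = merge-label t u
inS   (merge t u) = merge-inS t u

sub-merge-both : ∀ t u {i} → i < arity t [] → i < arity u [] →
                 sub (merge t u) i ≅ merge (sub t i) (sub u i)
sub-merge-both t u {i} i<t i<u = mk≅ agree
  where
  agree : sub (merge t u) i ≡T merge (sub t i) (sub u i)
  agree p _ with i <? arity t [] | i <? arity u []
  ... | yes _  | yes _  = refl , λ _ → refl
  ... | no i≮t | _      = ⊥-elim (i≮t i<t)
  ... | yes _  | no i≮u = ⊥-elim (i≮u i<u)

sub-merge-left : ∀ t u {i} → i < arity t [] → ¬ i < arity u [] → sub (merge t u) i ≅ sub t i
sub-merge-left t u {i} i<t i≮u = mk≅ agree
  where
  agree : sub (merge t u) i ≡T sub t i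
  agree p _ with i <? arity t [] | i <? arity u []
  ... | yes _  | no _   = refl , λ _ → refl
  ... | no i≮t | _      = ⊥-elim (i≮t i<t)
  ... | yes _  | yes i<u = ⊥-elim (i≮u i<u)

sub-merge-right : ∀ t u {i} → ¬ i < arity t [] → i < arity u [] → sub (merge t u) i ≅ sub u i
sub-merge-right t u {i} i≮t i<u = mk≅ agree
  where
  agree : sub (merge t u) i ≡T sub u i
  agree p _ with i <? arity t [] | i <? arity u []
  ... | no _    | yes _  = refl , λ _ → refl
  ... | yes i<t | _      = ⊥-elim (i≮t i<t)
  ... | no _    | no i≮u = ⊥-elim (i≮u i<u)

merge-idem : ∀ t → t ≡T merge t t
merge-idem t .[] root = sym (⊔-idem (arity t [])) , λ _ → refl
merge-idem t .(i ∷ p) (step {i} {p} i<t n) with i <? arity t []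
... | yes _  = merge-idem (sub t i) p n
... | no i≮t = ⊥-elim (i≮t i<t)

module _ (dec : DecE′) where

  cut-dropped-E′ : ∀ {π n ch} k le fx i →
                   proj₁ (cut dec π n ch k le fx) ≤ i → i < k → E′ (ch i)
  cut-dropped-E′ zero _ _ _ _ ()
  cut-dropped-E′ {π} {ch = ch} (suc k) le fx i h i<k with dec (ch k) | app π k ≟ k
  ... | no _  | _     = ⊥-elim (<⇒≱ i<k h)
  ... | yes _ | no _  = ⊥-elim (<⇒≱ i<k h)
  ... | yes E′ch | yes _ with m≤n⇒m<n∨m≡n i<k
  ...   | inj₁ i<1+k = cut-dropped-E′ k _ _ i h (≤-pred i<1+k)
  ...   | inj₂ refl  = E′ch

  cut-cong : ∀ {π π′ n n′ ch ch′} → π ≐ π′ → ∀ k →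
             (∀ i → i < k → E′ (ch i) ⇔ E′ (ch′ i)) → ∀ le fx le′ fx′ →
             proj₁ (cut dec π n ch k le fx) ≡ proj₁ (cut dec π′ n′ ch′ k le′ fx′)
  cut-cong π≐π′ zero _ _ _ _ _ = refl
  cut-cong {π} {π′} {ch = ch} {ch′} π≐π′ (suc k) E′⇔ le fx le′ fx′
    with dec (ch k) | app π k ≟ k | dec (ch′ k) | app π′ k ≟ k
  ... | yes _ | yes _  | yes _ | yes _  =
        cut-cong π≐π′ k (λ i h → E′⇔ i (m≤n⇒m≤1+n h)) _ _ _ _
  ... | yes E′ch | yes _ | no ¬E′ch′ | _    = ⊥-elim (¬E′ch′ (Equivalence.to (E′⇔ k ≤-refl) E′ch))
  ... | no ¬E′ch | _    | yes E′ch′ | yes _ = ⊥-elim (¬E′ch (Equivalence.from (E′⇔ k ≤-refl) E′ch′))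
  ... | yes _ | yes πk | yes _ | no ¬π′k = ⊥-elim (¬π′k (trans (sym (π≐π′ k)) πk))
  ... | yes _ | no ¬πk | yes _ | yes π′k = ⊥-elim (¬πk (trans (π≐π′ k) π′k))
  ... | yes _ | no _   | yes _ | no _   = refl
  ... | yes _ | no _   | no _  | _      = refl
  ... | no _  | _      | yes _ | no _   = refl
  ... | no _  | _      | no _  | _      = refl

  cut-skip-E′ : ∀ {π n ch m} → Fixes π m → ∀ k → m ≤ k →
                (∀ i → m ≤ i → i < k → E′ (ch i)) → ∀ le fx le′ fx′ →
                proj₁ (cut dec π n ch k le fx) ≡ proj₁ (cut dec π n ch m le′ fx′)
  cut-skip-E′ _ zero z≤n _ _ _ _ _ = refl
  cut-skip-E′ {π} {ch = ch} π-fixes (suc k) m≤1+k E′-ch le fx le′ fx′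
    with m≤n⇒m<n∨m≡n m≤1+k
  ... | inj₂ refl = cut-cong (λ _ → refl) (suc k) (λ _ _ → mk⇔ id id) le fx le′ fx′
  ... | inj₁ m<1+k with dec (ch k) | app π k ≟ k
  ...   | yes _ | yes _ =
          cut-skip-E′ π-fixes k (≤-pred m<1+k) (λ i m≤i i<k → E′-ch i m≤i (m≤n⇒m≤1+n i<k)) _ _ le′ fx′
  ...   | no ¬E′ch | _   = ⊥-elim (¬E′ch (E′-ch k (≤-pred m<1+k) ≤-refl))
  ...   | yes _ | no ¬πk = ⊥-elim (¬πk (π-fixes k (≤-pred m<1+k)))

  m′-arity≤ : ∀ t → arity (m′ dec t) [] ≤ arity t []
  m′-arity≤ t = proj₁ (proj₂ (cutAt dec t []))

  m′-dropped-E′ : ∀ t i → arity (m′ dec t) [] ≤ i → i < arity t [] → E′ (sub t i)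
  m′-dropped-E′ t = cut-dropped-E′ (arity t []) ≤-refl (inS t [])

  module PostFixed {R : PT → PT → Set} (post : ∀ x y → R x y → Φ R x y) where

    E′-forward : ∀ {x y} → R x y → E′ x → E′ y
    E′-forward {x} {y} r (e′ id-x E′-ch) with post x y r
    ... | lab , ar , R-ch , _ =
      e′ (λ q → trans (sym (lab q)) (id-x q))
         (λ i h → E′-forward (R-ch i h) (E′-ch i (<-≤-trans h ar)))

    E′-backward : ∀ {x y} → R x y → E′ y → E′ x
    E′-backward {x} {y} r (e′ id-y E′-ch) with post x y r
    ... | lab , _ , R-ch , extra-E′ =
      e′ (λ q → trans (lab q) (id-y q)) E′-ch-x
      where
      E′-ch-x : ∀ i → i < arity x [] → E′ (sub x i)
      E′-ch-x i h with i <? arity y []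
      ... | yes h′ = E′-backward (R-ch i h′) (E′-ch i h′)
      ... | no h′  = extra-E′ i (≮⇒≥ h′) h

    m′-arity-root : ∀ {w t} → R w t → arity (m′ dec w) [] ≡ arity (m′ dec t) []
    m′-arity-root {w} {t} r with post w t r
    ... | lab , ar , R-ch , extra-E′ = begin
      proj₁ (cut dec (label w []) (arity w []) (λ i → sub w i) (arity w []) ≤-refl (inS w []))
        ≡⟨ cut-skip-E′ w-fixes (arity w []) ar extra-E′ ≤-refl (inS w []) ar w-fixes ⟩
      proj₁ (cut dec (label w []) (arity w []) (λ i → sub w i) (arity t []) ar w-fixes)
        ≡⟨ cut-cong lab (arity t []) (λ i h → mk⇔ (E′-forward (R-ch i h)) (E′-backward (R-ch i h)))
                    ar w-fixes ≤-refl (inS t []) ⟩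
      proj₁ (cut dec (label t []) (arity t []) (λ i → sub t i) (arity t []) ≤-refl (inS t [])) ∎
      where
      open ≡-Reasoning
      w-fixes : Fixes (label w []) (arity t [])
      w-fixes p h = trans (lab p) (inS t [] p h)

    m′-≡T : ∀ {w t} → R w t → m′ dec w ≡T m′ dec t
    m′-≡T {w} {t} r .[] root = m′-arity-root r , proj₁ (post w t r)
    m′-≡T {w} {t} r .(i ∷ p) (step {i} {p} h n) =
      m′-≡T (proj₁ (proj₂ (proj₂ (post w t r))) i h′) p n
      where
      h′ : i < arity t []
      h′ = <-≤-trans (subst (i <_) (m′-arity-root r) h) (m′-arity≤ t)

  ≤′⇒m′-≅ : ∀ {w t} → w ≤′ t → m′ dec w ≅ m′ dec t
  ≤′⇒m′-≅ (_ , post , r) = mk≅ (PostFixed.m′-≡T post r)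

  E′⇒≤′ε̄ : ∀ {t} → E′ t → t ≤′ ε̄
  E′⇒≤′ε̄ E′t = (λ x y → E′ x × y ≡ ε̄) , post , E′t , refl
    where
    post : ∀ x y → E′ x × y ≡ ε̄ → Φ (λ x y → E′ x × y ≡ ε̄) x y
    post x .ε̄ (e′ id-x E′-ch , refl) = id-x , z≤n , (λ _ ()) , λ i _ → E′-ch i

  E′⇒m′-≅ : ∀ {t u} → E′ t → E′ u → m′ dec t ≅ m′ dec u
  E′⇒m′-≅ E′t E′u = ≅-trans (≤′⇒m′-≅ (E′⇒≤′ε̄ E′t)) (≅-sym (≤′⇒m′-≅ (E′⇒≤′ε̄ E′u)))

  m′-≅-sub : ∀ t u {i} → m′ dec t ≅ m′ dec u → i < arity t [] → i < arity u [] →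
             m′ dec (sub t i) ≅ m′ dec (sub u i)
  m′-≅-sub t u {i} t≈u i<t i<u with i <? arity (m′ dec t) []
  ... | yes i<m′t = ≅-sub t≈u i<m′t
  ... | no i≮m′t  = E′⇒m′-≅ (m′-dropped-E′ t i m′t≤i i<t) (m′-dropped-E′ u i m′u≤i i<u)
    where
    m′t≤i : arity (m′ dec t) [] ≤ i
    m′t≤i = ≮⇒≥ i≮m′t
    m′u≤i : arity (m′ dec u) [] ≤ i
    m′u≤i = subst (_≤ i) (≅-arity t≈u) m′t≤i

  m′-≅-extra-E′ : ∀ t u {i} → m′ dec t ≅ m′ dec u → arity t [] ≤ i → i < arity u [] →
                  E′ (sub u i)
  m′-≅-extra-E′ t u {i} t≈u t≤i =
    m′-dropped-E′ u i (subst (_≤ i) (≅-arity t≈u) (≤-trans (m′-arity≤ t) t≤i))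

  merge-comm : ∀ {t u} → m′ dec t ≅ m′ dec u → merge t u ≡T merge u t
  merge-comm {t} {u} t≈u .[] root = ⊔-comm (arity t []) (arity u []) , ≅-label t≈u
  merge-comm {t} {u} t≈u .(i ∷ p) (step {i} {p} _ n) with i <? arity t [] | i <? arity u []
  ... | yes i<t | yes i<u =
        merge-comm (m′-≅-sub t u t≈u i<t i<u) p (≅-Node (sub-merge-both t u i<t i<u) n)
  ... | yes _ | no _  = refl , λ _ → refl
  ... | no _  | yes _ = refl , λ _ → refl
  ... | no _  | no _  = refl , λ _ → refl

  -- Stated up to ≅ since sub (merge t u) i equals merge (sub t i) (sub u i) only nodewise.
  merge-≤′ : ∀ {x t u} → x ≅ merge t u → m′ dec t ≅ m′ dec u → x ≤′ t
  merge-≤′ x≅tu t≈u = R , post , _ , x≅tu , t≈u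
    where
    R : PT → PT → Set
    R x y = Σ PT λ u → (x ≅ merge y u) × (m′ dec y ≅ m′ dec u)

    post : ∀ x y → R x y → Φ R x y
    post x y (u , x≅yu , y≈u) = ≅-label x≅yu , y≤x , R-ch , extra-E′
      where
      y≤x : arity y [] ≤ arity x []
      y≤x = subst (_ ≤_) (sym (≅-arity x≅yu)) (m≤m⊔n (arity y []) (arity u []))

      R-ch : ∀ i → i < arity y [] → R (sub x i) (sub y i)
      R-ch i i<y with i <? arity u []
      ... | yes i<u = sub u i ,
                      ≅-trans (≅-sub x≅yu (<-≤-trans i<y y≤x)) (sub-merge-both y u i<y i<u) ,
                      m′-≅-sub y u y≈u i<y i<u
      ... | no i≮u  = sub y i ,
                      ≅-trans (≅-sub x≅yu (<-≤-trans i<y y≤x))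
                        (≅-trans (sub-merge-left y u i<y i≮u) (mk≅ (merge-idem (sub y i)))) ,
                      ≅-refl

      extra-E′ : ∀ i → arity y [] ≤ i → i < arity x [] → E′ (sub x i)
      extra-E′ i y≤i i<x =
        E′-≅ (≅-sym (≅-trans (≅-sub x≅yu i<x) (sub-merge-right y u (≤⇒≯ y≤i) i<u)))
             (m′-≅-extra-E′ y u y≈u y≤i i<u)
        where
        i<u : i < arity u []
        i<u = ≰⇒> λ u≤i → <⇒≱ (subst (i <_) (≅-arity x≅yu) i<x) (⊔-lub y≤i u≤i)

  σ′⇒m′-≅ : ∀ {t u} → σ′ t u → m′ dec t ≅ m′ dec u
  σ′⇒m′-≅ (_ , w≤t , w≤u) = ≅-trans (≅-sym (≤′⇒m′-≅ w≤t)) (≤′⇒m′-≅ w≤u)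

  m′-≅⇒σ′ : ∀ {t u} → m′ dec t ≅ m′ dec u → σ′ t u
  m′-≅⇒σ′ {t} {u} t≈u =
    merge t u , merge-≤′ ≅-refl t≈u , merge-≤′ (mk≅ (merge-comm t≈u)) (≅-sym t≈u)

proposition3p28 : (dec : DecE′) → (t u : PT) →
    σ′ t u ⇔ (m′ dec t ≡T m′ dec u)
proposition3p28 dec t u = mk⇔ (nodewise ∘ σ′⇒m′-≅ dec) (m′-≅⇒σ′ dec ∘ mk≅)
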